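{- For all integers $k\ge 2$, $2\le\ell\le k$ and $0\le h\le t$, the quantity $n(\ell,t,h)$ defined below (with respect to $k$-level service patterns) satisfies $$n(\ell,t,h)\le 2^{(\ell-1)(\ell-1+t)^2\cdot 2^{\ell-1+t-h}}.$$
   Context: Fix $k$. Let $U$ be a finite set of pages and $\sigma=\sigma_1,\dots,\sigma_T$ with $\sigma_t\in U$. A ($k$-level, hierarchical) service pattern is $\mathcal I=\mathcal I_1\cup\dots\cup\mathcal I_k$, where each $\mathcal I_i$ is a partition of $[0,T+1)$ into half-open intervals with integer endpoints (the level-$i$ intervals), such that every level-$i$ interval with $i<k$ is contained in a level-$(i+1)$ interval. The ancestors $A(I)$ of $I$ are the higher-level intervals containing $I$; $T_I$ consists of $I$ and all lower-level intervals contained in $I$; the children of a level-$\ell$ interval are the level-$(\ell-1)$ intervals contained in it. A labeling is a partial map $\alpha$ from intervals to $U$; a labeling of a set $\mathcal J$ of intervals is feasible for $\sigma_I$ (requests at times $t\in I\cap\{1,\dots,T\}$) if for every such $t$ some $J\in\mathcal J$ with $t\in J$ has $\alpha(J)=\sigma_t$. For a level-$\ell$ interval $I$ with $\ell\ge2$ and children $C$, the joint request list $L(C)$ is the set of inclusion-minimal $S\subseteq U$ with $|S|\le k-\ell+1$ such that some labeling of $T_I\cup A(I)$, feasible for $\sigma_I$, labels each interval of $\{I\}\cup A(I)$ either not at all or by an element of $S$. A $t$-tuple is a set of size $t$. $n(\ell,t,h)$ is the supremum, over all finite $U$, request sequences, $k$-level service patterns, level-$\ell$ intervals $I$ and sets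 $P\subseteq U$ with $|P|=h$, of the number of $t$-tuples in the joint request list of the children of $I$ that contain $P$. -}

module Defs where

open import Data.Nat using (ℕ; zero; suc; _+_; _*_; _∸_; _^_; _≤_; _<_)
open import Data.Fin using (Fin; toℕ)
open import Data.Fin.Subset using (Subset; _⊂_; ∣_∣) renaming (_∈_ to _∈ₛ_)
open import Data.Maybe using (Maybe; just; nothing)
open import Data.Product using (Σ; ∃; ∃-syntax; _×_; _,_)
open import Data.Sum using (_⊎_)
open import Relation.Nullary using (¬_)
open import Relation.Binary.PropositionalEquality using (_≡_)

-- A half-open integer interval [a , b) is represented by the pair (a , b).
Interval : Set
Interval = ℕ × ℕ

_∈ᵢ_ : ℕ → Interval → Set
x ∈ᵢ (a , b) = a ≤ x × x < b

_⊆ᵢ_ : Interval → Interval → Set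
J ⊆ᵢ I = ∀ x → x ∈ᵢ J → x ∈ᵢ I

IsPartition : ℕ → (Interval → Set) → Set
IsPartition T P =
  (∀ J → P J → (Data.Product.proj₁ J < Data.Product.proj₂ J) × (Data.Product.proj₂ J ≤ suc T))
  × (∀ x → x < suc T → ∃[ J ] (P J × x ∈ᵢ J))
  × (∀ J J′ x → P J → P J′ → x ∈ᵢ J → x ∈ᵢ J′ → J ≡ J′)

-- A k-level hierarchical service pattern on [0 , T+1).
-- Lev i J : J is a level-i interval.  Intervals are tagged by their level,
-- so the same real interval occurring at two levels gives two distinct intervals.
record ServicePattern (k T : ℕ) : Set₁ where
  field
    Lev       : ℕ → Interval → Set
    lev-range : ∀ i J → Lev i J → (1 ≤ i) × (i ≤ k)
    partition : ∀ i → 1 ≤ i → i ≤ k → IsPartition T (Lev i)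
    nested    : ∀ i J → 1 ≤ i → i < k → Lev i J → ∃[ J′ ] (Lev (suc i) J′ × J ⊆ᵢ J′)

module _ {k T u : ℕ} (𝓘 : ServicePattern k T) (σ : Fin T → Fin u) where
  open ServicePattern 𝓘

  -- the request at position i : Fin T is issued at time t = suc (toℕ i) ∈ {1..T}

  InT : ℕ → Interval → ℕ → Interval → Set
  InT ℓ I j J = (j ≡ ℓ × J ≡ I) ⊎ (j < ℓ × Lev j J × J ⊆ᵢ I)

  InA : ℕ → Interval → ℕ → Interval → Set
  InA ℓ I j J = ℓ < j × Lev j J × I ⊆ᵢ J

  Labeling : Set
  Labeling = ℕ → Interval → Maybe (Fin u)

  Feasible : ℕ → Interval → Labeling → Set
  Feasible ℓ I α = ∀ (i : Fin T) → suc (toℕ i) ∈ᵢ I →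
    ∃[ j ] ∃[ J ] ((InT ℓ I j J ⊎ InA ℓ I j J) × suc (toℕ i) ∈ᵢ J × α j J ≡ just (σ i))

  Good : ℕ → Interval → Subset u → Set
  Good ℓ I S = ∃[ α ] (Feasible ℓ I α ×
    (∀ j J → (j ≡ ℓ × J ≡ I) ⊎ InA ℓ I j J →
       (α j J ≡ nothing) ⊎ (∃[ x ] (α j J ≡ just x × x ∈ₛ S))))

  InJointRequestList : ℕ → Interval → Subset u → Set
  InJointRequestList ℓ I S =
    ∣ S ∣ ≤ k ∸ ℓ + 1 × Good ℓ I S × (∀ S′ → S′ ⊂ S → ¬ Good ℓ I S′)

-- For a level-j interval v and a set X of pages, either some labeling of the levels 1 … j serves
-- every request in v whose page lies outside X, or a list W of at most w(j) pages outside X blocks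
-- this: every labeling leaves some request in v with page in W unserved, where w(0) = 1 and
-- w(j+1) = w(j) + w(j)².  By induction on j: unless all children of v are servable for X, one child
-- has a blocker W₀; if for some a ∈ W₀ all children are servable for X ∪ {a}, labeling v by a serves
-- v, and otherwise W₀ together with the children's blockers for the sets X ∪ {a}, a ∈ W₀, blocks v.
--
-- For the children of the level-ℓ interval I and a set P this says: either P itself can label I and
-- its ancestors, and then minimality forces every member of L(C) containing P to be P, or every member
-- of L(C) meets a fixed list of w(ℓ−1) pages outside P.  Recursing on P ∪ {a} bounds the number of
-- t-tuples containing P by w(ℓ−1)^(t−∣P∣), and w(j) < 2^(2^j) gives the stated bound.

module Submission where

open import Defs
open import Data.Nat using (ℕ; zero; suc; _+_; _*_; _∸_; _^_; _≤_; _<_; z≤n; s≤s; _≤?_; _<?_; _≟_; NonZero)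
open import Data.Nat.Properties
open import Data.Nat.ListAction using (sum)
open import Data.Fin using (Fin; toℕ) renaming (zero to fzero; suc to fsuc)
open import Data.Fin.Properties using (any?) renaming (_≟_ to _≟ᶠ_)
open import Data.Fin.Subset using (Subset; _⊆_; _⊂_; ∣_∣; _∪_; ⁅_⁆; inside; outside)
  renaming (_∈_ to _∈ₛ_; _∉_ to _∉ₛ_)
open import Data.Fin.Subset.Properties
  using (_∈?_; _⊂?_; ⊆-antisym; x∈p∪q⁻; p⊆p∪q; q⊆p∪q; x∈⁅x⁆; x∈⁅y⁆⇒x≡y; p⊆q⇒∣p∣≤∣q∣; p⊂q⇒∣p∣<∣q∣)
import Data.Vec as Vec
open import Data.List using (List; []; _∷_; _++_; length; map; filter)
open import Data.List.Properties using (length-++; length-map; filter-accept)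
open import Data.List.Membership.Propositional using () renaming (_∈_ to _∈ˡ_)
open import Data.List.Membership.Propositional.Properties using (∈-map⁺; ∈-map⁻; ∈-++⁺ˡ; ∈-++⁺ʳ)
import Data.List.Membership.DecPropositional as DecMembership
open import Data.List.Relation.Unary.All as All using (All; []; _∷_)
import Data.List.Relation.Unary.All.Properties as All
open import Data.List.Relation.Unary.Any as Any using (Any; here; there)
open import Data.List.Relation.Unary.Unique.Propositional using (Unique)
import Data.List.Relation.Unary.Unique.Propositional.Properties as Unique
open import Data.List.Relation.Unary.AllPairs using ([]; _∷_)
open import Data.Maybe using (Maybe; just; nothing)
open import Data.Maybe.Properties using (just-injective) renaming (≡-dec to ≡-decᵐ)
open import Data.Product using (Σ-syntax; ∃-syntax; _×_; _,_; proj₁; proj₂)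
open import Data.Empty using (⊥-elim)
open import Data.Sum using (_⊎_; inj₁; inj₂; [_,_]′)
import Data.Sum as Sum
open import Relation.Nullary using (¬_; Dec; yes; no; ¬?)
open import Relation.Nullary.Decidable using (_×-dec_; decidable-stable)
open import Function using (case_of_)
open import Relation.Binary.PropositionalEquality using (_≡_; _≢_; refl; sym; trans; cong; subst)

module _ {A : Set} where

  lookup? : List A → ℕ → Maybe A
  lookup? []       _       = nothing
  lookup? (x ∷ xs) zero    = just x
  lookup? (x ∷ xs) (suc n) = lookup? xs n

  lookup?-∈ : ∀ xs n → lookup? xs n ≡ nothing ⊎ ∃[ x ] (lookup? xs n ≡ just x × x ∈ˡ xs)
  lookup?-∈ []       n       = inj₁ refl
  lookup?-∈ (x ∷ xs) zero    = inj₂ (x , refl , here refl)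
  lookup?-∈ (x ∷ xs) (suc n) = Sum.map₂ (λ (y , eq , y∈) → y , eq , there y∈) (lookup?-∈ xs n)

  lookup?-complete : ∀ {xs x} → x ∈ˡ xs → ∃[ n ] (n < length xs × lookup? xs n ≡ just x)
  lookup?-complete (here refl) = 0 , s≤s z≤n , refl
  lookup?-complete (there x∈) with n , n< , eq ← lookup?-complete x∈ = suc n , s≤s n< , eq

  any⊎all : {P Q : A → Set} {xs : List A} → All (λ x → P x ⊎ Q x) xs → Any P xs ⊎ All Q xs
  any⊎all []             = inj₂ []
  any⊎all (inj₁ p ∷ _)   = inj₁ (here p)
  any⊎all (inj₂ q ∷ pqs) = Sum.map there (q ∷_) (any⊎all pqs)

  unique-all-≡⇒length≤1 : ∀ {y : A} {xs} → Unique xs → All (y ≡_) xs → length xs ≤ 1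
  unique-all-≡⇒length≤1 []                  _                  = z≤n
  unique-all-≡⇒length≤1 (_ ∷ [])            _                  = s≤s z≤n
  unique-all-≡⇒length≤1 ((x≢x′ ∷ _) ∷ _ ∷ _) (refl ∷ refl ∷ _) = ⊥-elim (x≢x′ refl)

module _ {A B : Set} {R : A → B → Set} (R? : ∀ a b → Dec (R a b)) where

  count : A → List B → ℕ
  count a xs = length (filter (R? a) xs)

  total : List A → List B → ℕ
  total W xs = sum (map (λ a → count a xs) W)

  count-∷ : ∀ a x xs → count a xs ≤ count a (x ∷ xs)
  count-∷ a x xs with R? a x
  ... | yes _ = n≤1+n _
  ... | no  _ = ≤-refl

  total-∷ : ∀ W x xs → total W xs ≤ total W (x ∷ xs)
  total-∷ []      x xs = z≤n
  total-∷ (a ∷ W) x xs = +-mono-≤ (count-∷ a x xs) (total-∷ W x xs)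

  total-∷-hit : ∀ W x xs → Any (λ a → R a x) W → total W xs < total W (x ∷ xs)
  total-∷-hit (a ∷ W) x xs (here r) rewrite filter-accept (R? a) {x} {xs} r =
    s≤s (+-monoʳ-≤ (count a xs) (total-∷ W x xs))
  total-∷-hit (a ∷ W) x xs (there h) =
    subst (_≤ total (a ∷ W) (x ∷ xs)) (+-suc (count a xs) (total W xs))
      (+-mono-≤ (count-∷ a x xs) (total-∷-hit W x xs h))

  length≤total : ∀ W xs → All (λ x → Any (λ a → R a x) W) xs → length xs ≤ total W xs
  length≤total W []       []         = z≤n
  length≤total W (x ∷ xs) (hit ∷ hits) = ≤-trans (s≤s (length≤total W xs hits)) (total-∷-hit W x xs hit)

sum-map-≤ : ∀ {A : Set} (f : A → ℕ) {b} {W : List A} → All (λ a → f a ≤ b) W → sum (map f W) ≤ length W * b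
sum-map-≤ f []         = z≤n
sum-map-≤ f (fa≤ ∷ bs) = +-mono-≤ fa≤ (sum-map-≤ f bs)

elements : ∀ {n} → Subset n → List (Fin n)
elements Vec.[]            = []
elements (inside  Vec.∷ p) = fzero ∷ map fsuc (elements p)
elements (outside Vec.∷ p) = map fsuc (elements p)

length-elements : ∀ {n} (p : Subset n) → length (elements p) ≡ ∣ p ∣
length-elements Vec.[]            = refl
length-elements (inside  Vec.∷ p) = cong suc (trans (length-map fsuc (elements p)) (length-elements p))
length-elements (outside Vec.∷ p) = trans (length-map fsuc (elements p)) (length-elements p)

∈-elements⁺ : ∀ {n} {p : Subset n} {x} → x ∈ₛ p → x ∈ˡ elements p
∈-elements⁺ {p = inside  Vec.∷ p} Vec.here      = here refl
∈-elements⁺ {p = inside  Vec.∷ p} (Vec.there x∈) = there (∈-map⁺ fsuc (∈-elements⁺ x∈))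
∈-elements⁺ {p = outside Vec.∷ p} (Vec.there x∈) = ∈-map⁺ fsuc (∈-elements⁺ x∈)

∈-elements⁻ : ∀ {n} (p : Subset n) {x} → x ∈ˡ elements p → x ∈ₛ p
∈-elements⁻ (inside  Vec.∷ p) (here refl) = Vec.here
∈-elements⁻ (inside  Vec.∷ p) (there x∈) with y , y∈ , refl ← ∈-map⁻ fsuc x∈ = Vec.there (∈-elements⁻ p y∈)
∈-elements⁻ (outside Vec.∷ p) x∈         with y , y∈ , refl ← ∈-map⁻ fsuc x∈ = Vec.there (∈-elements⁻ p y∈)

module _ {n : ℕ} where

  ⊆⇒⊂⊎≡ : {p q : Subset n} → p ⊆ q → p ⊂ q ⊎ p ≡ q
  ⊆⇒⊂⊎≡ {p} {q} p⊆q with p ⊂? q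
  ... | yes p⊂q = inj₁ p⊂q
  ... | no  p⊄q = inj₂ (⊆-antisym p⊆q λ {x} x∈q →
                    decidable-stable (x ∈? p) (λ x∉p → p⊄q (p⊆q , x , x∈q , x∉p)))

  ∪⁅⁆-⊆ : {p q : Subset n} {x : Fin n} → p ⊆ q → x ∈ₛ q → p ∪ ⁅ x ⁆ ⊆ q
  ∪⁅⁆-⊆ {p} {q} {x} p⊆q x∈q y∈ with x∈p∪q⁻ p ⁅ x ⁆ y∈
  ... | inj₁ y∈p   = p⊆q y∈p
  ... | inj₂ y∈⁅x⁆ = subst (_∈ₛ q) (sym (x∈⁅y⁆⇒x≡y x y∈⁅x⁆)) x∈q

  ∣p∣<∣p∪⁅x⁆∣ : {p : Subset n} {x : Fin n} → x ∉ₛ p → ∣ p ∣ < ∣ p ∪ ⁅ x ⁆ ∣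
  ∣p∣<∣p∪⁅x⁆∣ {p} {x} x∉p = p⊂q⇒∣p∣<∣q∣ (p⊆p∪q ⁅ x ⁆ , x , q⊆p∪q p ⁅ x ⁆ (x∈⁅x⁆ x) , x∉p)

  _⊕_ : Subset n → Maybe (Fin n) → Subset n
  X ⊕ nothing = X
  X ⊕ just a  = X ∪ ⁅ a ⁆

  ∈-⊕⁻ : ∀ X p {x} → x ∈ₛ X ⊕ p → x ∈ₛ X ⊎ p ≡ just x
  ∈-⊕⁻ X nothing  x∈ = inj₁ x∈
  ∈-⊕⁻ X (just a) x∈ = Sum.map₂ (λ x∈⁅a⁆ → cong just (sym (x∈⁅y⁆⇒x≡y a x∈⁅a⁆))) (x∈p∪q⁻ X ⁅ a ⁆ x∈)

_∈ᵢ?_ : (x : ℕ) (J : Interval) → Dec (x ∈ᵢ J)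
x ∈ᵢ? (a , b) = (a ≤? x) ×-dec (x <? b)

start∈ : ∀ {x J} → x ∈ᵢ J → proj₁ J ∈ᵢ J
start∈ (a≤x , x<b) = ≤-refl , ≤-<-trans a≤x x<b

search-∈ᵢ : ∀ {P Q : ℕ → Set} (v : Interval) → (∀ z → z ∈ᵢ v → P z ⊎ Q z) →
            (∀ z → z ∈ᵢ v → P z) ⊎ ∃[ z ] (z ∈ᵢ v × Q z)
search-∈ᵢ (a , zero)          _ = inj₁ λ _ ()
search-∈ᵢ {P} {Q} (a , suc b) f
  with search-∈ᵢ {P} {Q} (a , b) (λ z (a≤z , z<b) → f z (a≤z , m<n⇒m<1+n z<b))
... | inj₂ (z , (a≤z , z<b) , q) = inj₂ (z , (a≤z , m<n⇒m<1+n z<b) , q)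
... | inj₁ below with b ∈ᵢ? (a , suc b)
...   | no  b∉ = inj₁ λ z (a≤z , z<1+b) → ⊥-elim (b∉ (≤-trans a≤z (m<1+n⇒m≤n z<1+b) , ≤-refl))
...   | yes b∈ with f b b∈
...     | inj₂ q = inj₂ (b , b∈ , q)
...     | inj₁ p = inj₁ λ z (a≤z , z<1+b) → [ (λ z<b → below z (a≤z , z<b)) , (λ { refl → p }) ]′
                                              (m≤n⇒m<n∨m≡n (m<1+n⇒m≤n z<1+b))

blockerSize : ℕ → ℕ
blockerSize zero    = 1
blockerSize (suc j) = blockerSize j + blockerSize j * blockerSize j

blockerSize-positive : ∀ j → 1 ≤ blockerSize j
blockerSize-positive zero    = ≤-refl
blockerSize-positive (suc j) = ≤-trans (blockerSize-positive j) (m≤m+n _ _)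

1≤blockerSize^ : ∀ j d → 1 ≤ blockerSize j ^ d
1≤blockerSize^ j d = subst (_≤ blockerSize j ^ d) (^-zeroˡ d) (^-monoˡ-≤ d (blockerSize-positive j))

module Levels {k T : ℕ} (𝓘 : ServicePattern k T) where
  open ServicePattern 𝓘

  -- The junk value (0 , 0) is returned unless 1 ≤ j ≤ k and x ≤ T.
  block : ℕ → ℕ → Interval
  block j x with 1 ≤? j | j ≤? k | x <? suc T
  ... | yes 1≤j | yes j≤k | yes x≤T = proj₁ (proj₁ (proj₂ (partition j 1≤j j≤k)) x x≤T)
  ... | _       | _       | _       = (0 , 0)

  block-spec : ∀ {j x} → 1 ≤ j → j ≤ k → x < suc T → Lev j (block j x) × x ∈ᵢ block j x
  block-spec {j} {x} 1≤j j≤k x≤T with 1 ≤? j | j ≤? k | x <? suc T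
  ... | yes 1≤j | yes j≤k | yes x≤T = proj₂ (proj₁ (proj₂ (partition j 1≤j j≤k)) x x≤T)
  ... | no  1≰j | _       | _       = ⊥-elim (1≰j 1≤j)
  ... | yes _   | no  j≰k | _       = ⊥-elim (j≰k j≤k)
  ... | yes _   | yes _   | no  x≰T = ⊥-elim (x≰T x≤T)

  ∈-Lev⇒<1+T : ∀ {j J x} → Lev j J → x ∈ᵢ J → x < suc T
  ∈-Lev⇒<1+T {j} {J} J-lev (_ , x<) =
    let 1≤j , j≤k = lev-range j J J-lev in ≤-trans x< (proj₂ (proj₁ (partition j 1≤j j≤k) J J-lev))

  Lev-disjoint : ∀ {j J J′ x} → Lev j J → Lev j J′ → x ∈ᵢ J → x ∈ᵢ J′ → J ≡ J′
  Lev-disjoint {j} {J} J-lev = let 1≤j , j≤k = lev-range j J J-lev in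
    proj₂ (proj₂ (partition j 1≤j j≤k)) J _ _ J-lev

  block-unique : ∀ {j J x} → Lev j J → x ∈ᵢ J → block j x ≡ J
  block-unique {j} {J} J-lev x∈J =
    let 1≤j , j≤k = lev-range j J J-lev
        lev , x∈  = block-spec 1≤j j≤k (∈-Lev⇒<1+T J-lev x∈J)
    in Lev-disjoint lev J-lev x∈ x∈J

  block-⊆-suc : ∀ {j x} → 1 ≤ j → j < k → x < suc T → block j x ⊆ᵢ block (suc j) x
  block-⊆-suc {j} {x} 1≤j j<k x≤T with block-spec 1≤j (<⇒≤ j<k) x≤T
  ... | lev , x∈ with nested j (block j x) 1≤j j<k lev
  ...   | J′ , J′-lev , ⊆J′ = subst (block j x ⊆ᵢ_) (sym (block-unique J′-lev (⊆J′ x x∈))) ⊆J′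

  block-mono : ∀ {j j′ x} → 1 ≤ j → j ≤ j′ → j′ ≤ k → x < suc T → block j x ⊆ᵢ block j′ x
  block-mono {j′ = j′} 1≤j j≤j′ j′≤k x≤T with m≤n⇒m<n∨m≡n j≤j′
  ... | inj₂ refl = λ _ y∈ → y∈
  block-mono {j′ = suc j′} 1≤j j≤j′ j′≤k x≤T | inj₁ (s≤s j≤j′-1) = λ y y∈ →
    block-⊆-suc (≤-trans 1≤j j≤j′-1) j′≤k x≤T y (block-mono 1≤j j≤j′-1 (<⇒≤ j′≤k) x≤T y y∈)

  block-⊆ : ∀ {j j′ J x} → Lev j′ J → x ∈ᵢ J → 1 ≤ j → j ≤ j′ → block j x ⊆ᵢ J
  block-⊆ {j′ = j′} {J} J-lev x∈J 1≤j j≤j′ = subst (_ ⊆ᵢ_) (block-unique J-lev x∈J)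
    (block-mono 1≤j j≤j′ (proj₂ (lev-range j′ J J-lev)) (∈-Lev⇒<1+T J-lev x∈J))

  ⊆-block : ∀ {j j′ J x} → Lev j J → x ∈ᵢ J → j ≤ j′ → j′ ≤ k → J ⊆ᵢ block j′ x
  ⊆-block {j} {J = J} J-lev x∈J j≤j′ j′≤k = subst (_⊆ᵢ _) (block-unique J-lev x∈J)
    (block-mono (proj₁ (lev-range j J J-lev)) j≤j′ j′≤k (∈-Lev⇒<1+T J-lev x∈J))

  Lev-block : ∀ {j j′ J x} → Lev j′ J → x ∈ᵢ J → 1 ≤ j → j ≤ j′ → Lev j (block j x)
  Lev-block {j′ = j′} {J} J-lev x∈J 1≤j j≤j′ =
    proj₁ (block-spec 1≤j (≤-trans j≤j′ (proj₂ (lev-range j′ J J-lev))) (∈-Lev⇒<1+T J-lev x∈J))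

  ∈-block : ∀ {j j′ J x} → Lev j′ J → x ∈ᵢ J → 1 ≤ j → j ≤ j′ → x ∈ᵢ block j x
  ∈-block {j′ = j′} {J} J-lev x∈J 1≤j j≤j′ =
    proj₂ (block-spec 1≤j (≤-trans j≤j′ (proj₂ (lev-range j′ J J-lev))) (∈-Lev⇒<1+T J-lev x∈J))

module Service {k T u : ℕ} (𝓘 : ServicePattern k T) (σ : Fin T → Fin u) where
  open ServicePattern 𝓘
  open Levels 𝓘

  time : Fin T → ℕ
  time i = suc (toℕ i)

  ServedUpTo : ℕ → Labeling 𝓘 σ → Fin T → Set
  ServedUpTo j α i = ∃[ j′ ] (1 ≤ j′ × j′ ≤ j × α j′ (block j′ (time i)) ≡ just (σ i))

  Serves : ℕ → Interval → Subset u → Labeling 𝓘 σ → Set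
  Serves j v X α = ∀ i → time i ∈ᵢ v → σ i ∈ₛ X ⊎ ServedUpTo j α i

  Servable : ℕ → Interval → Subset u → Set
  Servable j v X = Σ[ α ∈ Labeling 𝓘 σ ] Serves j v X α

  Misses : Labeling 𝓘 σ → ℕ → Interval → List (Fin u) → Set
  Misses α j v W = ∃[ i ] (time i ∈ᵢ v × σ i ∈ˡ W × ¬ ServedUpTo j α i)

  Unservable : ℕ → Interval → List (Fin u) → Set
  Unservable j v W = ∀ α → Misses α j v W

  Blocker : ℕ → Interval → Subset u → Set
  Blocker j v X = Σ[ W ∈ List (Fin u) ] (length W ≤ blockerSize j × All (_∉ₛ X) W × Unservable j v W)

  ServableOrBlocked : ℕ → Interval → Set
  ServableOrBlocked j v = ∀ X → Servable j v X ⊎ Blocker j v X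

  ChildrenServable : ℕ → Interval → Subset u → Set
  ChildrenServable j v X = ∀ z → z ∈ᵢ v → Servable j (block j z) X

  ChildBlocker : ℕ → Interval → Subset u → Set
  ChildBlocker j v X = ∃[ z ] (z ∈ᵢ v × Blocker j (block j z) X)

  open DecMembership (_≟ᶠ_ {u}) using () renaming (_∈?_ to _∈ˡ?_)

  _≟ᵐ_ : (p q : Maybe (Fin u)) → Dec (p ≡ q)
  _≟ᵐ_ = ≡-decᵐ _≟ᶠ_

  ¬ServedUpTo-zero : ∀ α {i} → ¬ ServedUpTo 0 α i
  ¬ServedUpTo-zero _ (suc _ , _ , () , _)

  ¬ServedUpTo-suc : ∀ {j v i} α → Lev (suc j) v → time i ∈ᵢ v →
                    α (suc j) v ≢ just (σ i) → ¬ ServedUpTo j α i → ¬ ServedUpTo (suc j) α i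
  ¬ServedUpTo-suc α v-lev i∈v αv≢σi ¬served (j′ , 1≤j′ , j′≤1+j , eq) with m≤n⇒m<n∨m≡n j′≤1+j
  ... | inj₁ j′<1+j = ¬served (j′ , 1≤j′ , m<1+n⇒m≤n j′<1+j , eq)
  ... | inj₂ refl   = αv≢σi (trans (cong (α _) (sym (block-unique v-lev i∈v))) eq)

  level-one : ∀ {v} → Lev 1 v → ServableOrBlocked 1 v
  level-one {v} v-lev X with any? (λ i → (time i ∈ᵢ? v) ×-dec ¬? (σ i ∈? X))
  ... | no none = inj₁ ((λ _ _ → nothing) , λ i i∈v →
                    inj₁ (decidable-stable (σ i ∈? X) λ σi∉X → none (i , i∈v , σi∉X)))
  ... | yes (i₁ , i₁∈v , σi₁∉X)
    with any? (λ i → (time i ∈ᵢ? v) ×-dec (¬? (σ i ∈? X) ×-dec ¬? (σ i ≟ᶠ σ i₁)))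
  ...   | no none = inj₁ ((λ _ _ → just (σ i₁)) , serve)
    where
      serve : Serves 1 v X (λ _ _ → just (σ i₁))
      serve i i∈v with σ i ∈? X
      ... | yes σi∈X = inj₁ σi∈X
      ... | no  σi∉X = inj₂ (1 , ≤-refl , ≤-refl , cong just (sym
                         (decidable-stable (σ i ≟ᶠ σ i₁) λ σi≢σi₁ → none (i , i∈v , σi∉X , σi≢σi₁))))
  ...   | yes (i₂ , i₂∈v , σi₂∉X , σi₂≢σi₁) =
    inj₂ (σ i₁ ∷ σ i₂ ∷ [] , ≤-refl , σi₁∉X ∷ σi₂∉X ∷ [] , unservable)
    where
      unservable : Unservable 1 v (σ i₁ ∷ σ i₂ ∷ [])
      unservable α with α 1 v ≟ᵐ just (σ i₁)
      ... | yes αv≡σi₁ = i₂ , i₂∈v , there (here refl) , ¬ServedUpTo-suc α v-lev i₂∈v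
                           (λ αv≡σi₂ → σi₂≢σi₁ (just-injective (trans (sym αv≡σi₂) αv≡σi₁))) (¬ServedUpTo-zero α)
      ... | no  αv≢σi₁ = i₁ , i₁∈v , here refl , ¬ServedUpTo-suc α v-lev i₁∈v αv≢σi₁ (¬ServedUpTo-zero α)

  setLevel : ℕ → Maybe (Fin u) → Labeling 𝓘 σ → Labeling 𝓘 σ
  setLevel j p α j′ J with j′ ≟ j
  ... | yes _ = p
  ... | no  _ = α j′ J

  setLevel-≡ : ∀ j p α J → setLevel j p α j J ≡ p
  setLevel-≡ j p α J with j ≟ j
  ... | yes _  = refl
  ... | no j≢j = ⊥-elim (j≢j refl)

  setLevel-< : ∀ {j′ j} p α J → j′ < j → setLevel j p α j′ J ≡ α j′ J
  setLevel-< {j′} {j} p α J j′<j with j′ ≟ j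
  ... | yes refl = ⊥-elim (<-irrefl refl j′<j)
  ... | no  _    = refl

  setLevel-serves : ∀ {j v X} p {α} → Serves j v (X ⊕ p) α → Serves (suc j) v X (setLevel (suc j) p α)
  setLevel-serves {j} {X = X} p {α} serves i i∈v with serves i i∈v
  ... | inj₂ (j′ , 1≤j′ , j′≤j , eq) = inj₂ (j′ , 1≤j′ , m≤n⇒m≤1+n j′≤j , trans (setLevel-< p α _ (s≤s j′≤j)) eq)
  ... | inj₁ σi∈X⊕p with ∈-⊕⁻ X p σi∈X⊕p
  ...   | inj₁ σi∈X = inj₁ σi∈X
  ...   | inj₂ p≡σi = inj₂ (suc j , s≤s z≤n , ≤-refl , trans (setLevel-≡ (suc j) p α _) p≡σi)

  module Glue {j v X} (1≤j : 1 ≤ j) (v-lev : Lev (suc j) v)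
              (serve : ChildrenServable j v X) where

    labelingAt : ℕ → Labeling 𝓘 σ
    labelingAt z with z ∈ᵢ? v
    ... | yes z∈v = proj₁ (serve z z∈v)
    ... | no  _   = λ _ _ → nothing

    labelingAt-serves : ∀ z → z ∈ᵢ v → Serves j (block j z) X (labelingAt z)
    labelingAt-serves z z∈v with z ∈ᵢ? v
    ... | yes z∈v′ = proj₂ (serve z z∈v′)
    ... | no  z∉v  = ⊥-elim (z∉v z∈v)

    -- Each child of v is named by its left endpoint, so every interval below it reads the same labeling.
    glued : Labeling 𝓘 σ
    glued j′ J = labelingAt (proj₁ (block j (proj₁ J))) j′ J

    glued-serves : Serves j v X glued
    glued-serves i i∈v = Sum.map₂ transfer (labelingAt-serves z z∈v i i∈child)
      where
        c-lev : Lev j (block j (time i))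
        c-lev = Lev-block v-lev i∈v 1≤j (n≤1+n j)
        i∈c : time i ∈ᵢ block j (time i)
        i∈c = ∈-block v-lev i∈v 1≤j (n≤1+n j)
        z = proj₁ (block j (time i))
        z∈c = start∈ i∈c
        z∈v : z ∈ᵢ v
        z∈v = block-⊆ v-lev i∈v 1≤j (n≤1+n j) z z∈c
        i∈child : time i ∈ᵢ block j z
        i∈child = subst (time i ∈ᵢ_) (sym (block-unique c-lev z∈c)) i∈c
        transfer : ServedUpTo j (labelingAt z) i → ServedUpTo j glued i
        transfer (j′ , 1≤j′ , j′≤j , eq) =
          j′ , 1≤j′ , j′≤j , trans (cong (λ c → labelingAt (proj₁ c) j′ _) same-child) eq
          where
            same-child : block j (proj₁ (block j′ (time i))) ≡ block j (time i)
            same-child = block-unique c-lev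
              (block-⊆ c-lev i∈c 1≤j′ j′≤j _ (start∈ (∈-block c-lev i∈c 1≤j′ j′≤j)))

  blockerPages : ∀ {j v X} → ChildBlocker j v X → List (Fin u)
  blockerPages (_ , _ , W , _) = W

  pagesOf : ∀ {j v X W} → All (λ a → ChildBlocker j v (X ∪ ⁅ a ⁆)) W → List (Fin u)
  pagesOf []       = []
  pagesOf (b ∷ bs) = blockerPages b ++ pagesOf bs

  length-pagesOf : ∀ {j v X W} (bs : All (λ a → ChildBlocker j v (X ∪ ⁅ a ⁆)) W) →
                   length (pagesOf bs) ≤ length W * blockerSize j
  length-pagesOf []                           = z≤n
  length-pagesOf ((_ , _ , W , len , _) ∷ bs) =
    subst (_≤ _) (sym (length-++ W)) (+-mono-≤ len (length-pagesOf bs))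

  pagesOf-∉ : ∀ {j v X W} (bs : All (λ a → ChildBlocker j v (X ∪ ⁅ a ⁆)) W) → All (_∉ₛ X) (pagesOf bs)
  pagesOf-∉ []                                    = []
  pagesOf-∉ {X = X} {a ∷ _} ((_ , _ , _ , _ , W∉ , _) ∷ bs) =
    All.++⁺ (All.map (λ x∉ x∈X → x∉ (p⊆p∪q ⁅ a ⁆ x∈X)) W∉) (pagesOf-∉ bs)

  ∈-pagesOf : ∀ {j v X W a x} (bs : All (λ a → ChildBlocker j v (X ∪ ⁅ a ⁆)) W) (a∈W : a ∈ˡ W) →
              x ∈ˡ blockerPages (All.lookup bs a∈W) → x ∈ˡ pagesOf bs
  ∈-pagesOf (b ∷ bs) (here refl) x∈ = ∈-++⁺ˡ x∈
  ∈-pagesOf (b ∷ bs) (there a∈W) x∈ = ∈-++⁺ʳ (blockerPages b) (∈-pagesOf bs a∈W x∈)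

  children-servable-or-blocked : ∀ {j v} → 1 ≤ j → Lev (suc j) v → (∀ {c} → Lev j c → ServableOrBlocked j c) →
                                 ∀ X → ChildrenServable j v X ⊎ ChildBlocker j v X
  children-servable-or-blocked 1≤j v-lev dichotomy X =
    search-∈ᵢ _ λ z z∈v → dichotomy (Lev-block v-lev z∈v 1≤j (n≤1+n _)) X

  module Step {j v} (1≤j : 1 ≤ j) (v-lev : Lev (suc j) v) where

    extend : ∀ {X} p → ChildrenServable j v (X ⊕ p) → Servable (suc j) v X
    extend p serve = setLevel (suc j) p (Glue.glued 1≤j v-lev serve) ,
                     setLevel-serves p (Glue.glued-serves 1≤j v-lev serve)

    lift : ∀ {z W W′} α → z ∈ᵢ v → (∀ {x} → x ∈ˡ W → x ∈ˡ W′) → (∀ {x} → x ∈ˡ W → α (suc j) v ≢ just x) →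
           Misses α j (block j z) W → Misses α (suc j) v W′
    lift α z∈v W⊆W′ αv≢ (i , i∈ , σi∈W , ¬served) =
      i , i∈v , W⊆W′ σi∈W , ¬ServedUpTo-suc α v-lev i∈v (αv≢ σi∈W) ¬served
      where i∈v = block-⊆ v-lev z∈v 1≤j (n≤1+n j) _ i∈

    -- If the label of v is a page b of W₀, the blocker of X ∪ {b} applies; otherwise the blocker of X does.
    combine : ∀ {X z₀} → z₀ ∈ᵢ v → ((W₀ , _) : Blocker j (block j z₀) X) →
              All (λ a → ChildBlocker j v (X ∪ ⁅ a ⁆)) W₀ → Blocker (suc j) v X
    combine {X} z₀∈v (W₀ , len₀ , W₀∉X , unservable₀) bs =
      W₀ ++ pagesOf bs , length≤ , All.++⁺ W₀∉X (pagesOf-∉ bs) , unservable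
      where
        length≤ : length (W₀ ++ pagesOf bs) ≤ blockerSize (suc j)
        length≤ = subst (_≤ _) (sym (length-++ W₀))
          (+-mono-≤ len₀ (≤-trans (length-pagesOf bs) (*-monoˡ-≤ (blockerSize j) len₀)))

        via-W₀ : ∀ α → (∀ {x} → x ∈ˡ W₀ → α (suc j) v ≢ just x) → Misses α (suc j) v (W₀ ++ pagesOf bs)
        via-W₀ α αv≢ = lift α z₀∈v ∈-++⁺ˡ αv≢ (unservable₀ α)

        by-label : ∀ α p → α (suc j) v ≡ p → Misses α (suc j) v (W₀ ++ pagesOf bs)
        by-label α nothing  αv≡ = via-W₀ α λ _ αv≡x → case trans (sym αv≡) αv≡x of λ ()
        by-label α (just b) αv≡ with b ∈ˡ? W₀
        ... | no  b∉W₀ = via-W₀ α λ x∈W₀ αv≡x →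
                           b∉W₀ (subst (_∈ˡ W₀) (just-injective (trans (sym αv≡x) αv≡)) x∈W₀)
        ... | yes b∈W₀ =
          let z , z∈v , W , _ , W∉ , unservable-b = All.lookup bs b∈W₀ in
          lift α z∈v (λ x∈W → ∈-++⁺ʳ W₀ (∈-pagesOf bs b∈W₀ x∈W))
            (λ {x} x∈W αv≡x → All.lookup W∉ x∈W (q⊆p∪q X ⁅ b ⁆
              (subst (_∈ₛ ⁅ b ⁆) (just-injective (trans (sym αv≡) αv≡x)) (x∈⁅x⁆ b))))
            (unservable-b α)

        unservable : Unservable (suc j) v (W₀ ++ pagesOf bs)
        unservable α = by-label α (α (suc j) v) refl

    servable-or-blocked-suc : (∀ {c} → Lev j c → ServableOrBlocked j c) → ServableOrBlocked (suc j) v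
    servable-or-blocked-suc dichotomy X with children-servable-or-blocked 1≤j v-lev dichotomy X
    ... | inj₁ serve = inj₁ (extend nothing serve)
    ... | inj₂ (z₀ , z₀∈v , b₀)
      with any⊎all (All.tabulate {xs = proj₁ b₀} λ {a} _ →
                      children-servable-or-blocked 1≤j v-lev dichotomy (X ∪ ⁅ a ⁆))
    ...   | inj₁ some = let a , serve = Any.satisfied some in inj₁ (extend (just a) serve)
    ...   | inj₂ bs   = inj₂ (combine z₀∈v b₀ bs)

  servable-or-blocked : ∀ j {v} → 1 ≤ j → Lev j v → ServableOrBlocked j v
  servable-or-blocked (suc zero)    _ v-lev = level-one v-lev
  servable-or-blocked (suc (suc j)) _ v-lev =
    Step.servable-or-blocked-suc (s≤s z≤n) v-lev (servable-or-blocked (suc j) (s≤s z≤n))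

module JointRequestList {k T u : ℕ} (𝓘 : ServicePattern k T) (σ : Fin T → Fin u)
                        {m : ℕ} (1≤m : 1 ≤ m) {I : Interval} (I-lev : ServicePattern.Lev 𝓘 (suc m) I) where
  open ServicePattern 𝓘
  open Levels 𝓘
  open Service 𝓘 σ

  ℓ : ℕ
  ℓ = suc m

  AllowedLabel : Subset u → Maybe (Fin u) → Set
  AllowedLabel S p = p ≡ nothing ⊎ ∃[ x ] (p ≡ just x × x ∈ₛ S)

  allowed-∈ : ∀ {S p x} → AllowedLabel S p → p ≡ just x → x ∈ₛ S
  allowed-∈ (inj₂ (_ , refl , x∈S)) refl = x∈S

  module Labels {P : Subset u} (∣P∣≤ : ∣ P ∣ ≤ k ∸ ℓ + 1) (serve : ChildrenServable m I P) where

    -- I and its ancestors at levels ℓ, ℓ + 1, … carry the elements of P in turn;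
    -- there are enough of them because ∣ P ∣ ≤ k − ℓ + 1.
    α : Labeling 𝓘 σ
    α j J with j <? ℓ
    ... | yes _ = Glue.glued 1≤m I-lev serve j J
    ... | no  _ = lookup? (elements P) (j ∸ ℓ)

    α-below : ∀ {j} J → j < ℓ → α j J ≡ Glue.glued 1≤m I-lev serve j J
    α-below {j} J j<ℓ with j <? ℓ
    ... | yes _   = refl
    ... | no  j≮ℓ = ⊥-elim (j≮ℓ j<ℓ)

    α-above : ∀ {j} J → ℓ ≤ j → α j J ≡ lookup? (elements P) (j ∸ ℓ)
    α-above {j} J ℓ≤j with j <? ℓ
    ... | yes j<ℓ = ⊥-elim (<⇒≱ j<ℓ ℓ≤j)
    ... | no  _   = refl

    ancestor-level≤k : ∀ {n} → n < length (elements P) → n + ℓ ≤ k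
    ancestor-level≤k {n} n< = m≤o∸n⇒m+n≤o n (proj₂ (lev-range ℓ I I-lev))
      (m<1+n⇒m≤n (subst (n <_) (+-comm (k ∸ ℓ) 1) (≤-trans (subst (n <_) (length-elements P) n<) ∣P∣≤)))

    feasible-∈P : ∀ i → time i ∈ᵢ I → ∀ {n} → n < length (elements P) → lookup? (elements P) n ≡ just (σ i) →
                  ∃[ j ] ∃[ J ] ((InT 𝓘 σ ℓ I j J ⊎ InA 𝓘 σ ℓ I j J) × time i ∈ᵢ J × α j J ≡ just (σ i))
    feasible-∈P i i∈I {zero} _ eq =
      ℓ , I , inj₁ (inj₁ (refl , refl)) , i∈I ,
      trans (α-above I ≤-refl) (trans (cong (lookup? (elements P)) (n∸n≡0 ℓ)) eq)
    feasible-∈P i i∈I {suc n} n< eq =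
      suc n + ℓ , block (suc n + ℓ) (time i) ,
      inj₂ (m<n+m ℓ (s≤s z≤n) , proj₁ J-spec , ⊆-block I-lev i∈I (m≤n+m ℓ (suc n)) (ancestor-level≤k n<)) ,
      proj₂ J-spec ,
      trans (α-above _ (m≤n+m ℓ (suc n))) (trans (cong (lookup? (elements P)) (m+n∸n≡m (suc n) ℓ)) eq)
      where J-spec = block-spec (s≤s z≤n) (ancestor-level≤k n<) (∈-Lev⇒<1+T I-lev i∈I)

    feasible : Feasible 𝓘 σ ℓ I α
    feasible i i∈I with σ i ∈? P
    ... | yes σi∈P = let n , n< , eq = lookup?-complete (∈-elements⁺ σi∈P) in feasible-∈P i i∈I n< eq
    ... | no  σi∉P with Glue.glued-serves 1≤m I-lev serve i i∈I
    ...   | inj₁ σi∈P = ⊥-elim (σi∉P σi∈P)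
    ...   | inj₂ (j , 1≤j , j≤m , eq) =
      j , block j (time i) ,
      inj₁ (inj₂ (s≤s j≤m , Lev-block I-lev i∈I 1≤j (m≤n⇒m≤1+n j≤m) , block-⊆ I-lev i∈I 1≤j (m≤n⇒m≤1+n j≤m))) ,
      ∈-block I-lev i∈I 1≤j (m≤n⇒m≤1+n j≤m) , trans (α-below _ (s≤s j≤m)) eq

    allowed : ∀ j J → (j ≡ ℓ × J ≡ I) ⊎ InA 𝓘 σ ℓ I j J → AllowedLabel P (α j J)
    allowed j J top = subst (AllowedLabel P) (sym (α-above J (ℓ≤j top)))
      (Sum.map₂ (λ (x , eq , x∈) → x , eq , ∈-elements⁻ P x∈) (lookup?-∈ (elements P) (j ∸ ℓ)))
      where
        ℓ≤j : (j ≡ ℓ × J ≡ I) ⊎ InA 𝓘 σ ℓ I j J → ℓ ≤ j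
        ℓ≤j (inj₁ (refl , _)) = ≤-refl
        ℓ≤j (inj₂ (ℓ<j , _))  = <⇒≤ ℓ<j

    good : Good 𝓘 σ ℓ I P
    good = α , feasible , allowed

  good-meets-unservable : ∀ {z W} S → z ∈ᵢ I → Unservable m (block m z) W → Good 𝓘 σ ℓ I S → Any (_∈ₛ S) W
  good-meets-unservable {z} S z∈I unservable (α , feasible , allowed) with unservable α
  ... | i , i∈c , σi∈W , ¬served = Any.map (λ { refl → σi∈S }) σi∈W
    where
      σi∈S : σ i ∈ₛ S
      σi∈S with feasible i (block-⊆ I-lev z∈I 1≤m (n≤1+n m) _ i∈c)
      ... | _ , _ , inj₁ (inj₁ (refl , refl)) , _ , eq = allowed-∈ (allowed ℓ I (inj₁ (refl , refl))) eq
      ... | j , J , inj₂ anc , _ , eq                 = allowed-∈ (allowed j J (inj₂ anc)) eq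
      ... | j , J , inj₁ (inj₂ (j<ℓ , J-lev , _)) , i∈J , eq = ⊥-elim (¬served
            (j , proj₁ (lev-range j J J-lev) , m<1+n⇒m≤n j<ℓ , trans (cong (α j) (block-unique J-lev i∈J)) eq))

  good-or-blocked : ∀ P → ∣ P ∣ ≤ k ∸ ℓ + 1 → Good 𝓘 σ ℓ I P ⊎
    ∃[ W ] (length W ≤ blockerSize m × All (_∉ₛ P) W × (∀ S → Good 𝓘 σ ℓ I S → Any (_∈ₛ S) W))
  good-or-blocked P ∣P∣≤ with children-servable-or-blocked 1≤m I-lev (servable-or-blocked m 1≤m) P
  ... | inj₁ serve = inj₁ (Labels.good ∣P∣≤ serve)
  ... | inj₂ (z , z∈I , W , len , W∉P , unservable) =
    inj₂ (W , len , W∉P , λ S → good-meets-unservable S z∈I unservable)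

  Candidate : ℕ → Subset u → Subset u → Set
  Candidate t P S = InJointRequestList 𝓘 σ ℓ I S × ∣ S ∣ ≡ t × P ⊆ S

  candidate-≡ : ∀ {t P S} → Candidate t P S → t ≤ ∣ P ∣ ⊎ Good 𝓘 σ ℓ I P → P ≡ S
  candidate-≡ ((_ , _ , minimal) , ∣S∣≡t , P⊆S) small-or-good with ⊆⇒⊂⊎≡ P⊆S | small-or-good
  ... | inj₂ P≡S | _            = P≡S
  ... | inj₁ P⊂S | inj₁ t≤∣P∣   = ⊥-elim (<⇒≱ (p⊂q⇒∣p∣<∣q∣ P⊂S) (≤-trans (≤-reflexive ∣S∣≡t) t≤∣P∣))
  ... | inj₁ P⊂S | inj₂ P-good  = ⊥-elim (minimal _ P⊂S P-good)

  candidates-≤ : ∀ d {t P} → t ≤ ∣ P ∣ + d → ∀ xs → Unique xs → All (Candidate t P) xs →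
                 length xs ≤ blockerSize m ^ d
  candidates-≤ _ _ [] _ _ = z≤n
  candidates-≤ zero {P = P} t≤ xs@(_ ∷ _) uniq cands =
    unique-all-≡⇒length≤1 uniq (All.map (λ c → candidate-≡ c (inj₁ t≤∣P∣)) cands)
    where t≤∣P∣ = subst (_ ≤_) (+-identityʳ ∣ P ∣) t≤
  candidates-≤ (suc d) {t} {P} t≤ xs@(_ ∷ _) uniq cands@(((∣S∣≤ , _) , _ , P⊆S) ∷ _)
    with good-or-blocked P (≤-trans (p⊆q⇒∣p∣≤∣q∣ P⊆S) ∣S∣≤)
  ... | inj₁ P-good = ≤-trans
    (unique-all-≡⇒length≤1 uniq (All.map (λ c → candidate-≡ c (inj₂ P-good)) cands)) (1≤blockerSize^ m (suc d))
  ... | inj₂ (W , len , W∉P , meets) = begin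
    length xs                    ≤⟨ length≤total _∈?_ W xs (All.map (λ ((_ , S-good , _) , _) → meets _ S-good) cands) ⟩
    total _∈?_ W xs              ≤⟨ sum-map-≤ (λ a → count _∈?_ a xs) (All.map containing W∉P) ⟩
    length W * blockerSize m ^ d ≤⟨ *-monoˡ-≤ _ len ⟩
    blockerSize m ^ suc d        ∎
    where
      open ≤-Reasoning
      containing : ∀ {a} → a ∉ₛ P → count _∈?_ a xs ≤ blockerSize m ^ d
      containing {a} a∉P = candidates-≤ d t≤′ (filter (a ∈?_) xs) (Unique.filter⁺ (a ∈?_) uniq)
        (All.zipWith add-a (All.filter⁺ (a ∈?_) cands , All.all-filter (a ∈?_) xs))
        where
          add-a : ∀ {S} → Candidate t P S × a ∈ₛ S → Candidate t (P ∪ ⁅ a ⁆) S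
          add-a ((in-list , ∣S∣≡t , P⊆S) , a∈S) = in-list , ∣S∣≡t , ∪⁅⁆-⊆ P⊆S a∈S

          t≤′ : t ≤ ∣ P ∪ ⁅ a ⁆ ∣ + d
          t≤′ = ≤-trans t≤ (subst (_≤ ∣ P ∪ ⁅ a ⁆ ∣ + d) (sym (+-suc ∣ P ∣ d)) (+-monoˡ-≤ d (∣p∣<∣p∪⁅x⁆∣ a∉P)))

n<2^n : ∀ n → n < 2 ^ n
n<2^n zero    = s≤s z≤n
n<2^n (suc n) = subst (2 + n ≤_) (cong (2 ^ n +_) (sym (+-identityʳ (2 ^ n))))
                  (+-mono-≤ (m^n>0 2 n) (n<2^n n))

2^m*n≤c*2^[m+n] : ∀ m n c .{{_ : NonZero c}} → 2 ^ m * n ≤ c * 2 ^ (m + n)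
2^m*n≤c*2^[m+n] m n c = begin
  2 ^ m * n       ≤⟨ *-monoʳ-≤ (2 ^ m) (<⇒≤ (n<2^n n)) ⟩
  2 ^ m * 2 ^ n   ≡⟨ ^-distribˡ-+-* 2 m n ⟨
  2 ^ (m + n)     ≤⟨ m≤n*m (2 ^ (m + n)) c ⟩
  c * 2 ^ (m + n) ∎
  where open ≤-Reasoning

blockerSize<2^2^ : ∀ j → blockerSize j < 2 ^ 2 ^ j
blockerSize<2^2^ zero    = ≤-refl
blockerSize<2^2^ (suc j) = begin-strict
  b + b * b             <⟨ s≤s (+-monoʳ-≤ b (*-monoʳ-≤ b (n≤1+n b))) ⟩
  suc b * suc b         ≤⟨ *-mono-≤ (blockerSize<2^2^ j) (blockerSize<2^2^ j) ⟩
  2 ^ 2 ^ j * 2 ^ 2 ^ j ≡⟨ ^-distribˡ-+-* 2 (2 ^ j) (2 ^ j) ⟨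
  2 ^ (2 ^ j + 2 ^ j)   ≡⟨ cong (λ e → 2 ^ (2 ^ j + e)) (+-identityʳ (2 ^ j)) ⟨
  2 ^ 2 ^ suc j         ∎
  where
    open ≤-Reasoning
    b = blockerSize j

blockerSize^≤ : ∀ j n → blockerSize j ^ n ≤ 2 ^ (2 ^ j * n)
blockerSize^≤ j n = ≤-trans (^-monoˡ-≤ n (<⇒≤ (blockerSize<2^2^ j))) (≤-reflexive (^-*-assoc 2 (2 ^ j) n))

lemma6 : (k ℓ t h : ℕ) → 2 ≤ k → 2 ≤ ℓ → ℓ ≤ k → h ≤ t →
    (u T : ℕ) (𝓘 : ServicePattern k T) (σ : Fin T → Fin u) (I : Interval) →
    ServicePattern.Lev 𝓘 ℓ I →
    (P : Subset u) → ∣ P ∣ ≡ h →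
    (xs : List (Subset u)) → Unique xs →
    All (λ S → InJointRequestList 𝓘 σ ℓ I S × ∣ S ∣ ≡ t × P ⊆ S) xs →
    length xs ≤ 2 ^ ((ℓ ∸ 1) * (ℓ ∸ 1 + t) ^ 2 * 2 ^ (ℓ ∸ 1 + t ∸ h))
lemma6 k (suc m@(suc _)) t h _ (s≤s (s≤s z≤n)) _ h≤t u T 𝓘 σ I I-lev P refl xs uniq cands = begin
  length xs                                     ≤⟨ candidates-≤ (t ∸ h) t≤h+[t∸h] xs uniq cands ⟩
  blockerSize m ^ (t ∸ h)                       ≤⟨ blockerSize^≤ m (t ∸ h) ⟩
  2 ^ (2 ^ m * (t ∸ h))                         ≤⟨ ^-monoʳ-≤ 2 (2^m*n≤c*2^[m+n] m (t ∸ h) (m * (m + t) ^ 2)) ⟩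
  2 ^ (m * (m + t) ^ 2 * 2 ^ (m + (t ∸ h)))     ≡⟨ cong (λ e → 2 ^ (m * (m + t) ^ 2 * 2 ^ e)) (+-∸-assoc m h≤t) ⟨
  2 ^ (m * (m + t) ^ 2 * 2 ^ (m + t ∸ h))       ∎
  where
    open ≤-Reasoning
    open JointRequestList 𝓘 σ (s≤s z≤n) I-lev using (candidates-≤)
    t≤h+[t∸h] : t ≤ h + (t ∸ h)
    t≤h+[t∸h] = ≤-reflexive (sym (m+[n∸m]≡n h≤t))
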